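{- Let $m\in\mathbb{N}$ and let $\phi\colon\{0,1\}^r\to[m]$ be monotone. If $\phi$ admits a perfect matching, then $([m],U)$ can be $r$-locally embedded, where $U$ is the uniform distribution on $[m]$.
   Context: $[m]=\{0,\ldots,m-1\}$; $\{0,1\}^r$ has the coordinatewise order. Let $A_i=\phi^{ -1}(i)$. $\phi$ admits a perfect matching if there are matchings $E_0,\ldots,E_{m-2}$, where $E_i$ consists of pairs $(x,y)$ with $x\in A_i$, $y\in A_{i+1}$, $x<y$, and $E_i$ covers every vertex of $A_i$ and of $A_{i+1}$. A distribution $([m],\mu_1)$ can be $r$-locally embedded if there exist $\phi'\colon\{0,1\}^r\to[m]$, maps $\Psi_\omega\colon[m]\to\{0,1\}^r$ ($\omega\in\Omega$) and a probability distribution $P$ on $\Omega$ such that: $\phi'$ and all $\Psi_\omega$ are monotone; $\phi'(x)\sim\mu_1$ when $x$ is uniform on $\{0,1\}^r$; $\Psi_\omega(y)$ is uniform on $\{0,1\}^r$ when $y\sim\mu_1$ and $\omega\sim P$ independently; and $\phi'\circ\Psi_\omega=\mathrm{id}_{[m]}$ for every $\omega$. -}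

module Defs where

open import Data.Bool using (Bool; true; false)
import Data.Bool as B
open import Data.Nat using (ℕ; zero; suc; _^_)
open import Data.Nat.Properties using (m^n≢0)
open import Data.Fin using (Fin; toℕ)
import Data.Fin as F
import Data.Fin.Properties as FP
open import Data.Vec using (Vec; []; _∷_)
open import Data.Vec.Properties using (≡-dec)
open import Data.Vec.Relation.Binary.Pointwise.Inductive using (Pointwise)
open import Data.List using (List; []; _∷_; map; _++_; foldr; allFin)
open import Data.Integer using (+_)
open import Data.Rational using (ℚ; 0ℚ; 1ℚ; _+_; _*_; _/_; _≤_)
open import Data.Product using (Σ; ∃; _×_; _,_)
open import Relation.Nullary using (¬_; yes; no)
open import Relation.Binary.PropositionalEquality using (_≡_; _≢_)

-- The cube {0,1}^r, with false = 0, true = 1.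
Cube : ℕ → Set
Cube r = Vec Bool r

_≤c_ : ∀ {r} → Cube r → Cube r → Set
_≤c_ = Pointwise B._≤_

_<c_ : ∀ {r} → Cube r → Cube r → Set
x <c y = x ≤c y × x ≢ y

MonotoneC : ∀ {r m} → (Cube r → Fin m) → Set
MonotoneC φ = ∀ x y → x ≤c y → φ x F.≤ φ y

MonotoneF : ∀ {r m} → (Fin m → Cube r) → Set
MonotoneF ψ = ∀ i j → i F.≤ j → ψ i ≤c ψ j

allCube : (r : ℕ) → List (Cube r)
allCube zero = [] ∷ []
allCube (suc r) = map (false ∷_) (allCube r) ++ map (true ∷_) (allCube r)

sumℚ : ∀ {A : Set} → List A → (A → ℚ) → ℚ
sumℚ xs f = foldr (λ a s → f a + s) 0ℚ xs

[_≡F_] : ∀ {m} → Fin m → Fin m → ℚ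
[ i ≡F j ] with i FP.≟ j
... | yes _ = 1ℚ
... | no _ = 0ℚ

[_≡C_] : ∀ {r} → Cube r → Cube r → ℚ
[ x ≡C y ] with ≡-dec B._≟_ x y
... | yes _ = 1ℚ
... | no _ = 0ℚ

cubeMass : ℕ → ℚ
cubeMass r = (+ 1 / (2 ^ r)) {{m^n≢0 2 r}}

-- Uniform distribution U on [m] (m ≥ 1 is forced by Fin m being inhabited).
uniform : ∀ {m} → Fin m → ℚ
uniform {suc k} i = + 1 / suc k

InLayer : ∀ {r m} → (Cube r → Fin m) → ℕ → Cube r → Set
InLayer φ i x = toℕ (φ x) ≡ i

PerfectMatching : ∀ {r m} → (Cube r → Fin m) → Set₁
PerfectMatching {r} {m} φ =
  Σ (ℕ → Cube r → Cube r → Set) λ E →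
    ∀ i → suc (suc i) Data.Nat.≤ m →
        (∀ x y → E i x y → InLayer φ i x × InLayer φ (suc i) y × x <c y)
      × (∀ x y y′ → E i x y → E i x y′ → y ≡ y′)
      × (∀ x x′ y → E i x y → E i x′ y → x ≡ x′)
      × (∀ x → InLayer φ i x → ∃ λ y → E i x y)
      × (∀ y → InLayer φ (suc i) y → ∃ λ x → E i x y)

-- ([m], μ) can be r-locally embedded.  The probability space (Ω, P) is taken
-- finite: Ω = Fin k with rational weights P.
LocallyEmbeddable : (r m : ℕ) → (Fin m → ℚ) → Set
LocallyEmbeddable r m μ =
  Σ (Cube r → Fin m) λ φ′ →
  Σ ℕ λ k →
  Σ (Fin k → Fin m → Cube r) λ Ψ →
  Σ (Fin k → ℚ) λ P →
      (∀ ω → 0ℚ ≤ P ω)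
    × sumℚ (allFin k) P ≡ 1ℚ
    × MonotoneC φ′
    × (∀ ω → MonotoneF (Ψ ω))
      -- φ′(x) ∼ μ for x uniform on {0,1}^r
    × (∀ i → sumℚ (allCube r) (λ x → cubeMass r * [ φ′ x ≡F i ]) ≡ μ i)
      -- Ψ_ω(y) uniform on {0,1}^r for y ∼ μ, ω ∼ P independent
    × (∀ z → sumℚ (allFin k) (λ ω → sumℚ (allFin m) (λ y →
                 P ω * (μ y * [ Ψ ω y ≡C z ]))) ≡ cubeMass r)
    × (∀ ω y → φ′ (Ψ ω y) ≡ y)

{-# OPTIONS --safe #-}
module Submission where

-- The perfect matchings compose to bijections A₀ → A₁ → ⋯ → A_{m-1}, so the
-- cube splits into chains c₀ < c₁ < ⋯ < c_{m-1} with c_i ∈ A_i, one through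
-- each point.  Hence all layers have the same size and φ pushes the uniform
-- measure forward to U.  Take Ω to be the cube with uniform weight and Ψ_w the
-- chain through w: Ψ_w(y) = z exactly when w lies on the chain C of z and
-- y = φ z, so z is hit with probability (|C| / 2^r) · (1 / m) = 1 / 2^r.

open import Defs
open import Data.Nat as Nat using (ℕ; zero; suc; _^_; NonZero)
import Data.Nat.Properties as ℕP
open import Data.Fin as F using (Fin; toℕ)
import Data.Fin.Properties as FP
open import Data.Bool as B using (true; false)
import Data.Bool.Properties as BP
open import Data.Vec using ([]; _∷_; replicate)
open import Data.Vec.Properties using (≡-dec)
import Data.Vec.Relation.Binary.Pointwise.Inductive as Pointwise
open import Data.List using (List; []; _∷_; map; _++_; allFin; tabulate; length; lookup)
import Data.List.Properties as LP
import Data.Integer as ℤ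
open ℤ using () renaming (+_ to pos)
import Data.Integer.Properties as ℤP
open import Data.Rational using (ℚ; 0ℚ; 1ℚ; _+_; _*_; _/_; _≤_; toℚᵘ)
open import Data.Rational.Properties
  using (toℚᵘ-injective; toℚᵘ-fromℚᵘ; toℚᵘ-homo-+; toℚᵘ-homo-*; nonNegative⁻¹; normalize-nonNeg;
         +-identityˡ; +-assoc; +-0-commutativeMonoid; *-identityˡ; *-identityʳ; *-zeroʳ; *-distribˡ-+)
open import Data.Rational.Solver using (module +-*-Solver)
open import Algebra.Bundles using (CommutativeMonoid)
open import Algebra.Properties.CommutativeSemigroup (CommutativeMonoid.commutativeSemigroup +-0-commutativeMonoid)
  using () renaming (interchange to +-interchange)
import Data.Rational.Unnormalised as ℚᵘ
import Data.Rational.Unnormalised.Properties as ℚᵘP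
open import Data.Product using (Σ; _×_; _,_; proj₁; proj₂)
open import Relation.Nullary using (Dec; yes; no; _×-dec_)
open import Relation.Binary.PropositionalEquality
open import Function using (_∘_; id)
open import Function.Bundles using (_⇔_; mk⇔; Equivalence)

pos-suc/1 : ∀ n → pos (suc n) / 1 ≡ 1ℚ + pos n / 1
pos-suc/1 n = toℚᵘ-injective (begin-equality
  toℚᵘ (pos (suc n) / 1)          ≃⟨ toℚᵘ-fromℚᵘ (ℚᵘ.mkℚᵘ (pos (suc n)) 0) ⟩
  ℚᵘ.mkℚᵘ (pos (suc n)) 0         ≃⟨ ℚᵘ.*≡* (cong (λ t → (pos 1 ℤ.+ t) ℤ.* pos 1) (sym (ℤP.*-identityʳ (pos n)))) ⟩
  ℚᵘ.1ℚᵘ ℚᵘ.+ ℚᵘ.mkℚᵘ (pos n) 0   ≃⟨ ℚᵘP.+-congʳ ℚᵘ.1ℚᵘ (toℚᵘ-fromℚᵘ (ℚᵘ.mkℚᵘ (pos n) 0)) ⟨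
  toℚᵘ 1ℚ ℚᵘ.+ toℚᵘ (pos n / 1)   ≃⟨ toℚᵘ-homo-+ 1ℚ (pos n / 1) ⟨
  toℚᵘ (1ℚ + pos n / 1)           ∎)
  where open ℚᵘP.≤-Reasoning

1/n*n≡1 : ∀ n .{{_ : NonZero n}} → (pos 1 / n) * (pos n / 1) ≡ 1ℚ
1/n*n≡1 (suc k) = toℚᵘ-injective (begin-equality
  toℚᵘ ((pos 1 / suc k) * (pos (suc k) / 1))
    ≃⟨ toℚᵘ-homo-* (pos 1 / suc k) (pos (suc k) / 1) ⟩
  toℚᵘ (pos 1 / suc k) ℚᵘ.* toℚᵘ (pos (suc k) / 1)
    ≃⟨ ℚᵘP.*-cong (toℚᵘ-fromℚᵘ (ℚᵘ.mkℚᵘ (pos 1) k)) (toℚᵘ-fromℚᵘ (ℚᵘ.mkℚᵘ (pos (suc k)) 0)) ⟩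
  ℚᵘ.1/ ℚᵘ.mkℚᵘ (pos (suc k)) 0 ℚᵘ.* ℚᵘ.mkℚᵘ (pos (suc k)) 0
    ≃⟨ ℚᵘP.*-inverseˡ (ℚᵘ.mkℚᵘ (pos (suc k)) 0) ⟩
  ℚᵘ.1ℚᵘ ∎)
  where open ℚᵘP.≤-Reasoning

open ≡-Reasoning

-- Indicators of decidable propositions

𝟙 : ∀ {P : Set} → Dec P → ℚ
𝟙 (yes _) = 1ℚ
𝟙 (no _) = 0ℚ

𝟙-⇔ : ∀ {P Q : Set} (p : Dec P) (q : Dec Q) → P ⇔ Q → 𝟙 p ≡ 𝟙 q
𝟙-⇔ (yes _) (yes _) _ = refl
𝟙-⇔ (no _) (no _) _ = refl
𝟙-⇔ (yes p) (no ¬q) P⇔Q with () ← ¬q (Equivalence.to P⇔Q p)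
𝟙-⇔ (no ¬p) (yes q) P⇔Q with () ← ¬p (Equivalence.from P⇔Q q)

𝟙-× : ∀ {P Q : Set} (p : Dec P) (q : Dec Q) → 𝟙 p * 𝟙 q ≡ 𝟙 (p ×-dec q)
𝟙-× (yes _) (yes _) = refl
𝟙-× (yes _) (no _) = refl
𝟙-× (no _) (yes _) = refl
𝟙-× (no _) (no _) = refl

𝟙-×-⇔ : ∀ {P Q R S : Set} (p : Dec P) (q : Dec Q) (r : Dec R) (s : Dec S) →
  (P × Q) ⇔ (R × S) → 𝟙 p * 𝟙 q ≡ 𝟙 r * 𝟙 s
𝟙-×-⇔ p q r s PQ⇔RS = begin
  𝟙 p * 𝟙 q         ≡⟨ 𝟙-× p q ⟩
  𝟙 (p ×-dec q)     ≡⟨ 𝟙-⇔ (p ×-dec q) (r ×-dec s) PQ⇔RS ⟩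
  𝟙 (r ×-dec s)     ≡⟨ 𝟙-× r s ⟨
  𝟙 r * 𝟙 s         ∎

infix 4 _≟C_
_≟C_ : ∀ {r} (x y : Cube r) → Dec (x ≡ y)
_≟C_ = ≡-dec B._≟_

[≡C]≡𝟙 : ∀ {r} (x y : Cube r) → [ x ≡C y ] ≡ 𝟙 (x ≟C y)
[≡C]≡𝟙 x y with x ≟C y
... | yes _ = refl
... | no _ = refl

[≡C]-sym : ∀ {r} (x y : Cube r) → [ x ≡C y ] ≡ [ y ≡C x ]
[≡C]-sym x y = begin
  [ x ≡C y ]  ≡⟨ [≡C]≡𝟙 x y ⟩
  𝟙 (x ≟C y)  ≡⟨ 𝟙-⇔ (x ≟C y) (y ≟C x) (mk⇔ sym sym) ⟩
  𝟙 (y ≟C x)  ≡⟨ [≡C]≡𝟙 y x ⟨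
  [ y ≡C x ]  ∎

[≡F]≡𝟙 : ∀ {m} (i j : Fin m) → [ i ≡F j ] ≡ 𝟙 (i FP.≟ j)
[≡F]≡𝟙 i j with i FP.≟ j
... | yes _ = refl
... | no _ = refl

-- Finite sums

module _ {A : Set} where

  sum-cong : (xs : List A) {f g : A → ℚ} → (∀ x → f x ≡ g x) → sumℚ xs f ≡ sumℚ xs g
  sum-cong [] f≗g = refl
  sum-cong (x ∷ xs) f≗g = cong₂ _+_ (f≗g x) (sum-cong xs f≗g)

  sum-++ : (xs ys : List A) (f : A → ℚ) → sumℚ (xs ++ ys) f ≡ sumℚ xs f + sumℚ ys f
  sum-++ [] ys f = sym (+-identityˡ _)
  sum-++ (x ∷ xs) ys f = trans (cong (f x +_) (sum-++ xs ys f)) (sym (+-assoc (f x) _ _))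

  sum-0 : (xs : List A) → sumℚ xs (λ _ → 0ℚ) ≡ 0ℚ
  sum-0 [] = refl
  sum-0 (x ∷ xs) = trans (+-identityˡ _) (sum-0 xs)

  sum-+ : (xs : List A) (f g : A → ℚ) → sumℚ xs (λ x → f x + g x) ≡ sumℚ xs f + sumℚ xs g
  sum-+ [] f g = refl
  sum-+ (x ∷ xs) f g =
    trans (cong ((f x + g x) +_) (sum-+ xs f g)) (+-interchange (f x) (g x) (sumℚ xs f) (sumℚ xs g))

  sum-*ˡ : (xs : List A) (c : ℚ) (f : A → ℚ) → sumℚ xs (λ x → c * f x) ≡ c * sumℚ xs f
  sum-*ˡ [] c f = sym (*-zeroʳ c)
  sum-*ˡ (x ∷ xs) c f = trans (cong (c * f x +_) (sum-*ˡ xs c f)) (sym (*-distribˡ-+ c (f x) _))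

sum-map : ∀ {A B : Set} (h : A → B) (xs : List A) (f : B → ℚ) → sumℚ (map h xs) f ≡ sumℚ xs (f ∘ h)
sum-map h [] f = refl
sum-map h (x ∷ xs) f = cong (f (h x) +_) (sum-map h xs f)

sum-swap : ∀ {A B : Set} (xs : List A) (ys : List B) (f : A → B → ℚ) →
  sumℚ xs (λ x → sumℚ ys (f x)) ≡ sumℚ ys (λ y → sumℚ xs (λ x → f x y))
sum-swap [] ys f = sym (sum-0 ys)
sum-swap (x ∷ xs) ys f = trans (cong (sumℚ ys (f x) +_) (sum-swap xs ys f))
  (sym (sum-+ ys (f x) (λ y → sumℚ xs (λ x → f x y))))

sum-allFin : ∀ {A : Set} n (g : Fin n → A) (f : A → ℚ) → sumℚ (allFin n) (f ∘ g) ≡ sumℚ (tabulate g) f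
sum-allFin n g f = begin
  sumℚ (allFin n) (f ∘ g)    ≡⟨ sum-map g (allFin n) f ⟨
  sumℚ (map g (allFin n)) f  ≡⟨ cong (λ xs → sumℚ xs f) (LP.map-tabulate id g) ⟩
  sumℚ (tabulate g) f        ∎

sum-lookup : ∀ {A : Set} (xs : List A) (f : A → ℚ) → sumℚ (allFin (length xs)) (f ∘ lookup xs) ≡ sumℚ xs f
sum-lookup xs f = trans (sum-allFin (length xs) (lookup xs) f) (cong (λ ys → sumℚ ys f) (LP.tabulate-lookup xs))

-- Double counting: both sides are the total weight of the pairs (x , y),
-- weighted by f x · e x y = g y · e′ y x.
sum-exchange : ∀ {A B : Set} (xs : List A) (ys : List B) (f : A → ℚ) (g : B → ℚ)
  (e : A → B → ℚ) (e′ : B → A → ℚ) →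
  (∀ x → sumℚ ys (e x) ≡ 1ℚ) → (∀ y → sumℚ xs (e′ y) ≡ 1ℚ) →
  (∀ x y → f x * e x y ≡ g y * e′ y x) → sumℚ xs f ≡ sumℚ ys g
sum-exchange xs ys f g e e′ Σe≡1 Σe′≡1 fe≡ge′ = begin
  sumℚ xs f                                     ≡⟨ sum-cong xs (λ x → trans (sym (*-identityʳ (f x))) (cong (f x *_) (sym (Σe≡1 x)))) ⟩
  sumℚ xs (λ x → f x * sumℚ ys (e x))           ≡⟨ sum-cong xs (λ x → sum-*ˡ ys (f x) (e x)) ⟨
  sumℚ xs (λ x → sumℚ ys (λ y → f x * e x y))   ≡⟨ sum-swap xs ys (λ x y → f x * e x y) ⟩
  sumℚ ys (λ y → sumℚ xs (λ x → f x * e x y))   ≡⟨ sum-cong ys (λ y → sum-cong xs (λ x → fe≡ge′ x y)) ⟩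
  sumℚ ys (λ y → sumℚ xs (λ x → g y * e′ y x))  ≡⟨ sum-cong ys (λ y → sum-*ˡ xs (g y) (e′ y)) ⟩
  sumℚ ys (λ y → g y * sumℚ xs (e′ y))          ≡⟨ sum-cong ys (λ y → trans (cong (g y *_) (Σe′≡1 y)) (*-identityʳ (g y))) ⟩
  sumℚ ys g                                     ∎

sum-1≡length : ∀ {A : Set} (xs : List A) → sumℚ xs (λ _ → 1ℚ) ≡ pos (length xs) / 1
sum-1≡length [] = refl
sum-1≡length (x ∷ xs) = trans (cong (1ℚ +_) (sum-1≡length xs)) (sym (pos-suc/1 (length xs)))

1/length*count≡1 : ∀ {A : Set} (xs : List A) n .{{_ : NonZero n}} → length xs ≡ n →
  (pos 1 / n) * sumℚ xs (λ _ → 1ℚ) ≡ 1ℚ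
1/length*count≡1 xs n |xs|≡n =
  trans (cong ((pos 1 / n) *_) (trans (sum-1≡length xs) (cong (λ k → pos k / 1) |xs|≡n))) (1/n*n≡1 n)

length-allCube : ∀ r → length (allCube r) ≡ 2 ^ r
length-allCube zero = refl
length-allCube (suc r) = begin
  length (map (false ∷_) (allCube r) ++ map (true ∷_) (allCube r))         ≡⟨ LP.length-++ (map (false ∷_) (allCube r)) ⟩
  length (map (false ∷_) (allCube r)) Nat.+ length (map (true ∷_) (allCube r)) ≡⟨ cong₂ Nat._+_ (LP.length-map _ (allCube r)) (LP.length-map _ (allCube r)) ⟩
  length (allCube r) Nat.+ length (allCube r)                                  ≡⟨ cong₂ Nat._+_ (length-allCube r) (trans (length-allCube r) (sym (ℕP.+-identityʳ _))) ⟩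
  2 ^ suc r                                                                  ∎

[∷≡C∷] : ∀ {r} b b′ (c x : Cube r) → [ b ∷ c ≡C b′ ∷ x ] ≡ 𝟙 (b B.≟ b′) * [ c ≡C x ]
[∷≡C∷] b b′ c x = begin
  [ b ∷ c ≡C b′ ∷ x ]               ≡⟨ [≡C]≡𝟙 (b ∷ c) (b′ ∷ x) ⟩
  𝟙 (b ∷ c ≟C b′ ∷ x)               ≡⟨ 𝟙-⇔ (b ∷ c ≟C b′ ∷ x) (b B.≟ b′ ×-dec c ≟C x) ∷≡∷⇔ ⟩
  𝟙 (b B.≟ b′ ×-dec c ≟C x)         ≡⟨ 𝟙-× (b B.≟ b′) (c ≟C x) ⟨
  𝟙 (b B.≟ b′) * 𝟙 (c ≟C x)         ≡⟨ cong (𝟙 (b B.≟ b′) *_) ([≡C]≡𝟙 c x) ⟨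
  𝟙 (b B.≟ b′) * [ c ≡C x ]         ∎
  where
  ∷≡∷⇔ : (b ∷ c ≡ b′ ∷ x) ⇔ (b ≡ b′ × c ≡ x)
  ∷≡∷⇔ = mk⇔ (λ { refl → refl , refl }) (λ (b≡b′ , c≡x) → cong₂ _∷_ b≡b′ c≡x)

sum-allCube-[≡C] : ∀ r (c : Cube r) → sumℚ (allCube r) (λ x → [ c ≡C x ]) ≡ 1ℚ
sum-allCube-[≡C] zero [] = refl
sum-allCube-[≡C] (suc r) (b ∷ c) = begin
  sumℚ (map (false ∷_) cube ++ map (true ∷_) cube) (λ x → [ b ∷ c ≡C x ])
    ≡⟨ sum-++ (map (false ∷_) cube) (map (true ∷_) cube) [ b ∷ c ≡C_] ⟩
  sumℚ (map (false ∷_) cube) (λ x → [ b ∷ c ≡C x ]) + sumℚ (map (true ∷_) cube) (λ x → [ b ∷ c ≡C x ])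
    ≡⟨ cong₂ _+_ (trans (sum-map (false ∷_) cube [ b ∷ c ≡C_]) (half false)) (trans (sum-map (true ∷_) cube [ b ∷ c ≡C_]) (half true)) ⟩
  𝟙 (b B.≟ false) + 𝟙 (b B.≟ true)
    ≡⟨ one-of b ⟩
  1ℚ ∎
  where
  cube = allCube r
  half : ∀ b′ → sumℚ cube (λ x → [ b ∷ c ≡C b′ ∷ x ]) ≡ 𝟙 (b B.≟ b′)
  half b′ = begin
    sumℚ cube (λ x → [ b ∷ c ≡C b′ ∷ x ])          ≡⟨ sum-cong cube ([∷≡C∷] b b′ c) ⟩
    sumℚ cube (λ x → 𝟙 (b B.≟ b′) * [ c ≡C x ])    ≡⟨ sum-*ˡ cube (𝟙 (b B.≟ b′)) _ ⟩
    𝟙 (b B.≟ b′) * sumℚ cube (λ x → [ c ≡C x ])    ≡⟨ cong (𝟙 (b B.≟ b′) *_) (sum-allCube-[≡C] r c) ⟩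
    𝟙 (b B.≟ b′) * 1ℚ                              ≡⟨ *-identityʳ _ ⟩
    𝟙 (b B.≟ b′)                                   ∎
  one-of : ∀ b → 𝟙 (b B.≟ false) + 𝟙 (b B.≟ true) ≡ 1ℚ
  one-of false = refl
  one-of true = refl

[suc≡Fsuc] : ∀ {m} (j i : Fin m) → [ F.suc j ≡F F.suc i ] ≡ [ j ≡F i ]
[suc≡Fsuc] j i = begin
  [ F.suc j ≡F F.suc i ]      ≡⟨ [≡F]≡𝟙 (F.suc j) (F.suc i) ⟩
  𝟙 (F.suc j FP.≟ F.suc i)    ≡⟨ 𝟙-⇔ (F.suc j FP.≟ F.suc i) (j FP.≟ i) (mk⇔ FP.suc-injective (cong F.suc)) ⟩
  𝟙 (j FP.≟ i)                ≡⟨ [≡F]≡𝟙 j i ⟨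
  [ j ≡F i ]                  ∎

sum-allFin-[≡F] : ∀ m (j : Fin m) → sumℚ (allFin m) (λ i → [ j ≡F i ]) ≡ 1ℚ
sum-allFin-[≡F] (suc m) j = begin
  [ j ≡F F.zero ] + sumℚ (tabulate F.suc) (λ i → [ j ≡F i ])
    ≡⟨ cong ([ j ≡F F.zero ] +_) (sum-allFin m F.suc (λ i → [ j ≡F i ])) ⟨
  [ j ≡F F.zero ] + sumℚ (allFin m) (λ i → [ j ≡F F.suc i ])
    ≡⟨ split j ⟩
  1ℚ ∎
  where
  split : ∀ j → [ j ≡F F.zero ] + sumℚ (allFin m) (λ i → [ j ≡F F.suc i ]) ≡ 1ℚ
  split F.zero = cong (1ℚ +_) (sum-0 (allFin m))
  split (F.suc j) = begin
    0ℚ + sumℚ (allFin m) (λ i → [ F.suc j ≡F F.suc i ])  ≡⟨ +-identityˡ _ ⟩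
    sumℚ (allFin m) (λ i → [ F.suc j ≡F F.suc i ])       ≡⟨ sum-cong (allFin m) ([suc≡Fsuc] j) ⟩
    sumℚ (allFin m) (λ i → [ j ≡F i ])                   ≡⟨ sum-allFin-[≡F] m j ⟩
    1ℚ                                                   ∎

-- Chains through a perfect matching

≤c-refl : ∀ {r} {x : Cube r} → x ≤c x
≤c-refl = Pointwise.refl BP.≤-refl

≤c-trans : ∀ {r} {x y z : Cube r} → x ≤c y → y ≤c z → x ≤c z
≤c-trans = Pointwise.trans BP.≤-trans

module Chains {r m : ℕ} (φ : Cube r → Fin m) (pm : PerfectMatching φ) where

  E : ℕ → Cube r → Cube r → Set
  E = proj₁ pm

  ℓ : Cube r → ℕ
  ℓ x = toℕ (φ x)

  module _ {i : ℕ} (i+2≤m : suc (suc i) Nat.≤ m) where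

    E-sound : ∀ {x y} → E i x y → ℓ x ≡ i × ℓ y ≡ suc i × x <c y
    E-sound = proj₁ (proj₂ pm i i+2≤m) _ _

    E-functional : ∀ {x y y′} → E i x y → E i x y′ → y ≡ y′
    E-functional = proj₁ (proj₂ (proj₂ pm i i+2≤m)) _ _ _

    E-injective : ∀ {x x′ y} → E i x y → E i x′ y → x ≡ x′
    E-injective = proj₁ (proj₂ (proj₂ (proj₂ pm i i+2≤m))) _ _ _

    E-covers-lower : ∀ x → ℓ x ≡ i → Σ (Cube r) (E i x)
    E-covers-lower = proj₁ (proj₂ (proj₂ (proj₂ (proj₂ pm i i+2≤m))))

    E-covers-upper : ∀ y → ℓ y ≡ suc i → Σ (Cube r) (λ x → E i x y)
    E-covers-upper = proj₂ (proj₂ (proj₂ (proj₂ (proj₂ pm i i+2≤m))))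

  -- Matching partners, made total by returning x itself wherever the
  -- matching E i says nothing about x.
  up : ℕ → Cube r → Cube r
  up i x with suc (suc i) Nat.≤? m | ℓ x Nat.≟ i
  ... | yes i+2≤m | yes x∈Aᵢ = proj₁ (E-covers-lower i+2≤m x x∈Aᵢ)
  ... | _ | _ = x

  down : ℕ → Cube r → Cube r
  down i x with suc (suc i) Nat.≤? m | ℓ x Nat.≟ suc i
  ... | yes i+2≤m | yes x∈Aᵢ₊₁ = proj₁ (E-covers-upper i+2≤m x x∈Aᵢ₊₁)
  ... | _ | _ = x

  module _ {i : ℕ} (i+2≤m : suc (suc i) Nat.≤ m) where

    E-up : ∀ {x} → ℓ x ≡ i → E i x (up i x)
    E-up {x} x∈Aᵢ with suc (suc i) Nat.≤? m | ℓ x Nat.≟ i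
    ... | yes i+2≤m′ | yes x∈Aᵢ′ = proj₂ (E-covers-lower i+2≤m′ x x∈Aᵢ′)
    ... | no i+2≰m | _ with () ← i+2≰m i+2≤m
    ... | yes _ | no x∉Aᵢ with () ← x∉Aᵢ x∈Aᵢ

    E-down : ∀ {x} → ℓ x ≡ suc i → E i (down i x) x
    E-down {x} x∈Aᵢ₊₁ with suc (suc i) Nat.≤? m | ℓ x Nat.≟ suc i
    ... | yes i+2≤m′ | yes x∈Aᵢ₊₁′ = proj₂ (E-covers-upper i+2≤m′ x x∈Aᵢ₊₁′)
    ... | no i+2≰m | _ with () ← i+2≰m i+2≤m
    ... | yes _ | no x∉Aᵢ₊₁ with () ← x∉Aᵢ₊₁ x∈Aᵢ₊₁

    ℓ-up : ∀ {x} → ℓ x ≡ i → ℓ (up i x) ≡ suc i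
    ℓ-up x∈Aᵢ = proj₁ (proj₂ (E-sound i+2≤m (E-up x∈Aᵢ)))

    ≤c-up : ∀ {x} → ℓ x ≡ i → x ≤c up i x
    ≤c-up x∈Aᵢ = proj₁ (proj₂ (proj₂ (E-sound i+2≤m (E-up x∈Aᵢ))))

    ℓ-down : ∀ {x} → ℓ x ≡ suc i → ℓ (down i x) ≡ i
    ℓ-down x∈Aᵢ₊₁ = proj₁ (E-sound i+2≤m (E-down x∈Aᵢ₊₁))

    up-down : ∀ {x} → ℓ x ≡ suc i → up i (down i x) ≡ x
    up-down x∈Aᵢ₊₁ = E-functional i+2≤m (E-up (ℓ-down x∈Aᵢ₊₁)) (E-down x∈Aᵢ₊₁)

    down-up : ∀ {x} → ℓ x ≡ i → down i (up i x) ≡ x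
    down-up x∈Aᵢ = E-injective i+2≤m (E-down (ℓ-up x∈Aᵢ)) (E-up x∈Aᵢ)

  climb : ℕ → Cube r → Cube r
  climb zero a = a
  climb (suc j) a = up j (climb j a)

  descend : ℕ → Cube r → Cube r
  descend zero x = x
  descend (suc j) x = descend j (down j x)

  private
    <-pred : ∀ {j} → suc j Nat.< m → j Nat.< m
    <-pred = ℕP.<-trans (ℕP.n<1+n _)

  ℓ-climb : ∀ {a} → ℓ a ≡ 0 → ∀ j → j Nat.< m → ℓ (climb j a) ≡ j
  ℓ-climb a∈A₀ zero _ = a∈A₀
  ℓ-climb a∈A₀ (suc j) j+1<m = ℓ-up j+1<m (ℓ-climb a∈A₀ j (<-pred j+1<m))

  ℓ-descend : ∀ j {x} → ℓ x ≡ j → j Nat.< m → ℓ (descend j x) ≡ 0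
  ℓ-descend zero x∈A₀ _ = x∈A₀
  ℓ-descend (suc j) x∈Aⱼ₊₁ j+1<m = ℓ-descend j (ℓ-down j+1<m x∈Aⱼ₊₁) (<-pred j+1<m)

  climb-descend : ∀ j {x} → ℓ x ≡ j → j Nat.< m → climb j (descend j x) ≡ x
  climb-descend zero _ _ = refl
  climb-descend (suc j) x∈Aⱼ₊₁ j+1<m =
    trans (cong (up j) (climb-descend j (ℓ-down j+1<m x∈Aⱼ₊₁) (<-pred j+1<m))) (up-down j+1<m x∈Aⱼ₊₁)

  descend-climb : ∀ j {a} → ℓ a ≡ 0 → j Nat.< m → descend j (climb j a) ≡ a
  descend-climb zero _ _ = refl
  descend-climb (suc j) a∈A₀ j+1<m =
    trans (cong (descend j) (down-up j+1<m (ℓ-climb a∈A₀ j (<-pred j+1<m)))) (descend-climb j a∈A₀ (<-pred j+1<m))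

  climb-mono : ∀ {a} → ℓ a ≡ 0 → ∀ {i j} → i Nat.≤′ j → j Nat.< m → climb i a ≤c climb j a
  climb-mono a∈A₀ Nat.≤′-refl _ = ≤c-refl
  climb-mono a∈A₀ (Nat.≤′-step {n = j} i≤′j) j+1<m =
    ≤c-trans (climb-mono a∈A₀ i≤′j (<-pred j+1<m)) (≤c-up j+1<m (ℓ-climb a∈A₀ j (<-pred j+1<m)))

  root : Cube r → Cube r
  root x = descend (ℓ x) x

  ℓ-root : ∀ x → ℓ (root x) ≡ 0
  ℓ-root x = ℓ-descend (ℓ x) refl (FP.toℕ<n (φ x))

  root-root : ∀ x → root (root x) ≡ root x
  root-root x rewrite ℓ-root x = refl

  chain : Cube r → Fin m → Cube r
  chain a i = climb (toℕ i) (root a)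

  φ-chain : ∀ a i → φ (chain a i) ≡ i
  φ-chain a i = FP.toℕ-injective (ℓ-climb (ℓ-root a) (toℕ i) (FP.toℕ<n i))

  root-chain : ∀ a i → root (chain a i) ≡ root a
  root-chain a i = begin
    descend (ℓ (chain a i)) (chain a i)  ≡⟨ cong (λ j → descend j (chain a i)) (cong toℕ (φ-chain a i)) ⟩
    descend (toℕ i) (chain a i)          ≡⟨ descend-climb (toℕ i) (ℓ-root a) (FP.toℕ<n i) ⟩
    root a                               ∎

  chain-self : ∀ x → chain x (φ x) ≡ x
  chain-self x = climb-descend (ℓ x) refl (FP.toℕ<n (φ x))

  chain-mono : ∀ a {i j} → i F.≤ j → chain a i ≤c chain a j
  chain-mono a i≤j = climb-mono (ℓ-root a) (ℕP.≤⇒≤′ i≤j) (FP.toℕ<n _)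

  chain≡⇔ : ∀ a i x → (chain a i ≡ x) ⇔ (root a ≡ root x × φ x ≡ i)
  chain≡⇔ a i x = mk⇔ (λ { refl → sym (root-chain a i) , φ-chain a i })
    (λ (a~x , φx≡i) → trans (cong₂ (λ b j → climb (toℕ j) b) a~x (sym φx≡i)) (chain-self x))

  [chain≡] : ∀ a i x → [ chain a i ≡C x ] ≡ [ root a ≡C root x ] * [ φ x ≡F i ]
  [chain≡] a i x = begin
    [ chain a i ≡C x ]                     ≡⟨ [≡C]≡𝟙 (chain a i) x ⟩
    𝟙 (chain a i ≟C x)                     ≡⟨ 𝟙-⇔ (chain a i ≟C x) (root a ≟C root x ×-dec φ x FP.≟ i) (chain≡⇔ a i x) ⟩
    𝟙 (root a ≟C root x ×-dec φ x FP.≟ i)  ≡⟨ 𝟙-× (root a ≟C root x) (φ x FP.≟ i) ⟨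
    𝟙 (root a ≟C root x) * 𝟙 (φ x FP.≟ i)  ≡⟨ cong₂ _*_ ([≡C]≡𝟙 (root a) (root x)) ([≡F]≡𝟙 (φ x) i) ⟨
    [ root a ≡C root x ] * [ φ x ≡F i ]    ∎

  [layer]*[root≡] : ∀ i x a → [ φ x ≡F i ] * [ root x ≡C a ] ≡ [ root a ≡C a ] * [ chain a i ≡C x ]
  [layer]*[root≡] i x a = begin
    [ φ x ≡F i ] * [ root x ≡C a ]        ≡⟨ cong₂ _*_ ([≡F]≡𝟙 (φ x) i) ([≡C]≡𝟙 (root x) a) ⟩
    𝟙 (φ x FP.≟ i) * 𝟙 (root x ≟C a)      ≡⟨ 𝟙-×-⇔ (φ x FP.≟ i) (root x ≟C a) (root a ≟C a) (chain a i ≟C x) (mk⇔ to from) ⟩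
    𝟙 (root a ≟C a) * 𝟙 (chain a i ≟C x)  ≡⟨ cong₂ _*_ ([≡C]≡𝟙 (root a) a) ([≡C]≡𝟙 (chain a i) x) ⟨
    [ root a ≡C a ] * [ chain a i ≡C x ]  ∎
    where
    to : φ x ≡ i × root x ≡ a → root a ≡ a × chain a i ≡ x
    to (φx≡i , rx≡a) = trans ra≡rx rx≡a , Equivalence.from (chain≡⇔ a i x) (ra≡rx , φx≡i)
      where
      ra≡rx : root a ≡ root x
      ra≡rx = trans (cong root (sym rx≡a)) (root-root x)
    from : root a ≡ a × chain a i ≡ x → φ x ≡ i × root x ≡ a
    from (ra≡a , chain≡x) with Equivalence.to (chain≡⇔ a i x) chain≡x
    ... | ra≡rx , φx≡i = φx≡i , trans (sym ra≡rx) ra≡a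

  rootCount : ℚ
  rootCount = sumℚ (allCube r) (λ a → [ root a ≡C a ])

  layer-size : ∀ i → sumℚ (allCube r) (λ x → [ φ x ≡F i ]) ≡ rootCount
  layer-size i = sum-exchange (allCube r) (allCube r) (λ x → [ φ x ≡F i ]) (λ a → [ root a ≡C a ])
    (λ x a → [ root x ≡C a ]) (λ a x → [ chain a i ≡C x ])
    (λ x → sum-allCube-[≡C] r (root x)) (λ a → sum-allCube-[≡C] r (chain a i))
    ([layer]*[root≡] i)

  chain-size : ∀ z → sumℚ (allCube r) (λ w → [ root w ≡C root z ]) ≡ sumℚ (allFin m) (λ _ → 1ℚ)
  chain-size z = sum-exchange (allCube r) (allFin m) (λ w → [ root w ≡C root z ]) (λ _ → 1ℚ)
    (λ w i → [ φ w ≡F i ]) (λ i w → [ chain z i ≡C w ])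
    (λ w → sum-allFin-[≡F] m (φ w)) (λ i → sum-allCube-[≡C] r (chain z i))
    (λ w i → begin
      [ root w ≡C root z ] * [ φ w ≡F i ]  ≡⟨ cong (_* [ φ w ≡F i ]) ([≡C]-sym (root w) (root z)) ⟩
      [ root z ≡C root w ] * [ φ w ≡F i ]  ≡⟨ [chain≡] z i w ⟨
      [ chain z i ≡C w ]                   ≡⟨ *-identityˡ _ ⟨
      1ℚ * [ chain z i ≡C w ]              ∎)

  sum-chain≡ : ∀ a x → sumℚ (allFin m) (λ i → [ chain a i ≡C x ]) ≡ [ root a ≡C root x ]
  sum-chain≡ a x = begin
    sumℚ (allFin m) (λ i → [ chain a i ≡C x ])                     ≡⟨ sum-cong (allFin m) (λ i → [chain≡] a i x) ⟩
    sumℚ (allFin m) (λ i → [ root a ≡C root x ] * [ φ x ≡F i ])    ≡⟨ sum-*ˡ (allFin m) [ root a ≡C root x ] _ ⟩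
    [ root a ≡C root x ] * sumℚ (allFin m) (λ i → [ φ x ≡F i ])    ≡⟨ cong ([ root a ≡C root x ] *_) (sum-allFin-[≡F] m (φ x)) ⟩
    [ root a ≡C root x ] * 1ℚ                                     ≡⟨ *-identityʳ _ ⟩
    [ root a ≡C root x ]                                          ∎

  cube-size : sumℚ (allCube r) (λ _ → 1ℚ) ≡ rootCount * sumℚ (allFin m) (λ _ → 1ℚ)
  cube-size = begin
    sumℚ cube (λ _ → 1ℚ)                                   ≡⟨ sum-cong cube (λ x → sum-allFin-[≡F] m (φ x)) ⟨
    sumℚ cube (λ x → sumℚ (allFin m) (λ i → [ φ x ≡F i ]))  ≡⟨ sum-swap cube (allFin m) (λ x i → [ φ x ≡F i ]) ⟩
    sumℚ (allFin m) (λ i → sumℚ cube (λ x → [ φ x ≡F i ]))  ≡⟨ sum-cong (allFin m) (λ i → trans (layer-size i) (sym (*-identityʳ rootCount))) ⟩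
    sumℚ (allFin m) (λ _ → rootCount * 1ℚ)                 ≡⟨ sum-*ˡ (allFin m) rootCount (λ _ → 1ℚ) ⟩
    rootCount * sumℚ (allFin m) (λ _ → 1ℚ)                 ∎
    where
    cube = allCube r

-- The embedding

cubeMass-nonNeg : ∀ r → 0ℚ ≤ cubeMass r
cubeMass-nonNeg r = nonNegative⁻¹ (cubeMass r) {{normalize-nonNeg 1 (2 ^ r) {{ℕP.m^n≢0 2 r}}}}

cubeMass*count : ∀ r → cubeMass r * sumℚ (allCube r) (λ _ → 1ℚ) ≡ 1ℚ
cubeMass*count r = 1/length*count≡1 (allCube r) (2 ^ r) {{ℕP.m^n≢0 2 r}} (length-allCube r)

sum-cubeMass : ∀ r → sumℚ (allFin (length (allCube r))) (λ _ → cubeMass r) ≡ 1ℚ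
sum-cubeMass r = begin
  sumℚ (allFin (length (allCube r))) (λ _ → cubeMass r)  ≡⟨ sum-lookup (allCube r) (λ _ → cubeMass r) ⟩
  sumℚ (allCube r) (λ _ → cubeMass r)                    ≡⟨ sum-cong (allCube r) (λ _ → *-identityʳ (cubeMass r)) ⟨
  sumℚ (allCube r) (λ _ → cubeMass r * 1ℚ)               ≡⟨ sum-*ˡ (allCube r) (cubeMass r) (λ _ → 1ℚ) ⟩
  cubeMass r * sumℚ (allCube r) (λ _ → 1ℚ)               ≡⟨ cubeMass*count r ⟩
  1ℚ                                                     ∎

module UniformEmbedding {r k : ℕ} (φ : Cube r → Fin (suc k)) (pm : PerfectMatching φ) where
  open Chains φ pm

  private
    u = pos 1 / suc k
    cm = cubeMass r
    chainLength = sumℚ (allFin (suc k)) (λ _ → 1ℚ)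

    u*chainLength≡1 : u * chainLength ≡ 1ℚ
    u*chainLength≡1 = 1/length*count≡1 (allFin (suc k)) (suc k) (LP.length-tabulate id)

    rearrange : ∀ a b c d → (a * b) * (c * d) ≡ c * (a * (b * d))
    rearrange = solve 4 (λ a b c d → (a :* b) :* (c :* d) := c :* (a :* (b :* d))) refl
      where open +-*-Solver

  Ψ : Fin (length (allCube r)) → Fin (suc k) → Cube r
  Ψ ω = chain (lookup (allCube r) ω)

  cm*rootCount≡u : cm * rootCount ≡ u
  cm*rootCount≡u = begin
    cm * rootCount                          ≡⟨ *-identityʳ _ ⟨
    (cm * rootCount) * 1ℚ                   ≡⟨ cong ((cm * rootCount) *_) u*chainLength≡1 ⟨
    (cm * rootCount) * (u * chainLength)    ≡⟨ rearrange cm rootCount u chainLength ⟩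
    u * (cm * (rootCount * chainLength))    ≡⟨ cong (λ t → u * (cm * t)) cube-size ⟨
    u * (cm * sumℚ (allCube r) (λ _ → 1ℚ))  ≡⟨ cong (u *_) (cubeMass*count r) ⟩
    u * 1ℚ                                  ≡⟨ *-identityʳ u ⟩
    u                                       ∎

  pushforward : ∀ i → sumℚ (allCube r) (λ x → cm * [ φ x ≡F i ]) ≡ uniform i
  pushforward i = begin
    sumℚ (allCube r) (λ x → cm * [ φ x ≡F i ])  ≡⟨ sum-*ˡ (allCube r) cm _ ⟩
    cm * sumℚ (allCube r) (λ x → [ φ x ≡F i ])  ≡⟨ cong (cm *_) (layer-size i) ⟩
    cm * rootCount                              ≡⟨ cm*rootCount≡u ⟩
    u                                           ∎

  mixture : ∀ z → sumℚ (allFin (length (allCube r))) (λ ω → sumℚ (allFin (suc k)) (λ y →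
                    cm * (uniform y * [ Ψ ω y ≡C z ]))) ≡ cm
  mixture z = begin
    sumℚ (allFin (length (allCube r))) (hits ∘ lookup (allCube r))  ≡⟨ sum-lookup (allCube r) hits ⟩
    sumℚ (allCube r) hits                                           ≡⟨ sum-cong (allCube r) hits≡ ⟩
    sumℚ (allCube r) (λ w → cm * (u * [ root w ≡C root z ]))        ≡⟨ scale (allCube r) (λ w → [ root w ≡C root z ]) ⟩
    cm * (u * sumℚ (allCube r) (λ w → [ root w ≡C root z ]))        ≡⟨ cong (λ t → cm * (u * t)) (chain-size z) ⟩
    cm * (u * chainLength)                                          ≡⟨ cong (cm *_) u*chainLength≡1 ⟩
    cm * 1ℚ                                                         ≡⟨ *-identityʳ cm ⟩
    cm                                                              ∎
    where
    hits : Cube r → ℚ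
    hits w = sumℚ (allFin (suc k)) (λ y → cm * (u * [ chain w y ≡C z ]))
    scale : ∀ {A : Set} (xs : List A) (f : A → ℚ) → sumℚ xs (λ x → cm * (u * f x)) ≡ cm * (u * sumℚ xs f)
    scale xs f = trans (sum-*ˡ xs cm (λ x → u * f x)) (cong (cm *_) (sum-*ˡ xs u f))
    hits≡ : ∀ w → hits w ≡ cm * (u * [ root w ≡C root z ])
    hits≡ w = trans (scale (allFin (suc k)) (λ y → [ chain w y ≡C z ])) (cong (λ t → cm * (u * t)) (sum-chain≡ w z))

lemma2p8 : (r m : ℕ) (φ : Cube r → Fin m) → MonotoneC φ → PerfectMatching φ →
    LocallyEmbeddable r m uniform
lemma2p8 r zero φ _ _ with () ← φ (replicate r false)
lemma2p8 r (suc k) φ φ-mono pm =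
  φ , length (allCube r) , Ψ , (λ _ → cubeMass r) ,
  (λ _ → cubeMass-nonNeg r) , sum-cubeMass r ,
  φ-mono , (λ ω _ _ → chain-mono (lookup (allCube r) ω)) ,
  pushforward , mixture , (λ ω → φ-chain (lookup (allCube r) ω))
  where
  open Chains φ pm
  open UniformEmbedding φ pm
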